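{- Let $G$ be a connected graph and let $C$ be an end-block of $G$ isomorphic to $C_4$. Then the outcome (which player has a winning strategy) of the S-game of the Maker-Breaker total domination game on $G$ is the same as on the graph $G\setminus C$ obtained from $G$ by deleting the four vertices of $C$.
   Context: The Maker-Breaker total domination game on a graph is played by Dominator and Staller, who alternately select a vertex not selected before. Dominator wins if at some point the set of vertices he has selected is a total dominating set (every vertex has a neighbour in it); otherwise Staller wins. The S-game is the game in which Staller moves first. On the empty graph (no vertices) Dominator is considered to win. An end-block of a graph is a block that intersects the other blocks in at most one vertex. -}

module Defs where

open import Data.Nat using (ℕ)
open import Data.Bool using (Bool; true; false; _∧_; not)
open import Data.Fin using (Fin)
open import Data.Fin.Subset using (Subset; _∈_; _∉_; _⊆_; _∪_; _─_; ⁅_⁆; Nonempty)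
open import Data.Vec using (lookup)
open import Data.Sum renaming (_⊎_ to _⊎'_)
open import Data.Product using (Σ; ∃; _×_; _,_)
open import Relation.Binary.PropositionalEquality using (_≡_; _≢_; refl)

-- A finite simple graph whose vertex set is a subset V of the universe Fin n.
-- Adjacency is given by a symmetric, loopless Boolean relation; only edges
-- between vertices of V count (see Adj).
record Graph (n : ℕ) : Set where
  field
    V      : Subset n
    E      : Fin n → Fin n → Bool
    E-sym  : ∀ u v → E u v ≡ E v u
    E-irr  : ∀ v → E v v ≡ false

open Graph public

module _ {n : ℕ} where

  Adj : Graph n → Fin n → Fin n → Set
  Adj G u v = (u ∈ V G) × (v ∈ V G) × (E G u v ≡ true)

  delE : Subset n → (Fin n → Fin n → Bool) → Fin n → Fin n → Bool
  delE B e u v = not (lookup B u) ∧ not (lookup B v) ∧ e u v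

  private
    ∧-swap : ∀ a b c d → c ≡ d → a ∧ b ∧ c ≡ b ∧ a ∧ d
    ∧-swap true  true  c .c refl = refl
    ∧-swap true  false c d  _    = refl
    ∧-swap false true  c d  _    = refl
    ∧-swap false false c d  _    = refl

    ∧-false : ∀ a b c → c ≡ false → a ∧ b ∧ c ≡ false
    ∧-false true  true  .false refl = refl
    ∧-false true  false c _ = refl
    ∧-false false b     c _ = refl

  _∖_ : Graph n → Subset n → Graph n
  G ∖ B = record
    { V     = V G ─ B
    ; E     = delE B (E G)
    ; E-sym = λ u v → ∧-swap (not (lookup B u)) (not (lookup B v)) (E G u v) (E G v u) (E-sym G u v)
    ; E-irr = λ v → ∧-false (not (lookup B v)) (not (lookup B v)) (E G v v) (E-irr G v)
    }

  data WalkIn (G : Graph n) (U : Subset n) : Fin n → Fin n → Set where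
    stay : ∀ {u} → u ∈ U → u ∈ V G → WalkIn G U u u
    step : ∀ {u w v} → u ∈ U → Adj G u w → WalkIn G U w v → WalkIn G U u v

  ConnectedIn : Graph n → Subset n → Set
  ConnectedIn G U = ∀ u v → u ∈ U → v ∈ U → WalkIn G U u v

  Connected : Graph n → Set
  Connected G = ConnectedIn G (V G)

  Nonseparable : Graph n → Subset n → Set
  Nonseparable G U =
    (U ⊆ V G) × Nonempty U × ConnectedIn G U × (∀ x → x ∈ U → ConnectedIn G (U ─ ⁅ x ⁆))

  IsBlock : Graph n → Subset n → Set
  IsBlock G B = Nonseparable G B × (∀ B′ → B ⊆ B′ → Nonseparable G B′ → B′ ⊆ B)

  IsEndBlock : Graph n → Subset n → Set
  IsEndBlock G B =
    IsBlock G B ×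
    (∀ B₁ B₂ y z → IsBlock G B₁ → IsBlock G B₂ → B₁ ≢ B → B₂ ≢ B →
       y ∈ B → y ∈ B₁ → z ∈ B → z ∈ B₂ → y ≡ z)

  InducesC4 : Graph n → Subset n → Set
  InducesC4 G B = Σ (Fin n) λ a → Σ (Fin n) λ b → Σ (Fin n) λ c → Σ (Fin n) λ d →
    (a ≢ b) × (a ≢ c) × (a ≢ d) × (b ≢ c) × (b ≢ d) × (c ≢ d) ×
    (∀ x → x ∈ B → (x ≡ a) ⊎' (x ≡ b) ⊎' (x ≡ c) ⊎' (x ≡ d)) ×
    (a ∈ B) × (b ∈ B) × (c ∈ B) × (d ∈ B) ×
    Adj G a b × Adj G b c × Adj G c d × Adj G d a ×
    (E G a c ≡ false) × (E G b d ≡ false)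

  IsTD : Graph n → Subset n → Set
  IsTD G D = ∀ v → v ∈ V G → ∃ λ u → u ∈ D × Adj G u v

  -- v is a vertex of G not yet selected (D = Dominator's, S = Staller's vertices)
  Free : Graph n → Subset n → Subset n → Fin n → Set
  Free G D S v = (v ∈ V G) × (v ∉ D) × (v ∉ S)

  -- Dominator has a winning strategy from position (D, S):
  --  DomWinsS: Staller to move;  DomWinsD: Dominator to move.
  -- Dominator wins as soon as his set is a total dominating set; if the
  -- board is exhausted without that, Staller wins.
  mutual
    data DomWinsS (G : Graph n) : Subset n → Subset n → Set where
      wonS   : ∀ {D S} → IsTD G D → DomWinsS G D S
      sMoves : ∀ {D S} → (∃ λ v → Free G D S v) →
               (∀ v → Free G D S v → DomWinsD G D (S ∪ ⁅ v ⁆)) → DomWinsS G D S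

    data DomWinsD (G : Graph n) : Subset n → Subset n → Set where
      wonD   : ∀ {D S} → IsTD G D → DomWinsD G D S
      dMoves : ∀ {D S} v → Free G D S v → DomWinsS G (D ∪ ⁅ v ⁆) S → DomWinsD G D S

  DominatorWinsSGame : Graph n → Set
  DominatorWinsSGame G = DomWinsS G Data.Fin.Subset.⊥ Data.Fin.Subset.⊥

-- At most one vertex a of the end-block C has neighbours outside C; let b, c, d
-- follow a around the cycle. Dominator totally dominates C exactly when he owns a
-- vertex of each diagonal {a, c} and {b, d}, and he can always answer Staller inside
-- a diagonal; so a winning strategy on G ∖ C lifts to G. Conversely, on G Staller
-- opens with a; Dominator must answer c, since otherwise Staller takes c and b has
-- no neighbour left. From then on Staller answers Dominator inside {b, d}, and as
-- Dominator never owns a, his winning strategy on G restricts to one on G ∖ C.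
module Submission where

open import Defs
open import Data.Nat using (ℕ; zero; suc; _+_; _≤_)
open import Data.Nat.Properties using (+-suc; +-identityʳ; +-monoˡ-≤; m≤n+m; ≤-trans; <⇒≱)
open import Data.Bool using (true; false; _∧_; not)
open import Data.Bool.Properties using () renaming (_≟_ to _≟ᵇ_)
open import Data.Fin using (Fin; _≟_)
open import Data.Fin.Properties using (any?)
open import Data.Fin.Subset
  using (Subset; _∈_; _∉_; _⊆_; _⊂_; _∪_; _─_; ⁅_⁆; ∣_∣; inside; outside)
  renaming (⊥ to ∅)
open import Data.Fin.Subset.Properties
  using (_∈?_; x∈p∪q⁻; p⊆p∪q; q⊆p∪q; x∈⁅x⁆; x∈⁅y⁆⇒x≡y; x∈p∧x∉q⇒x∈p─q; p─q⊆p; ∉⊥; p⊂q⇒∣p∣<∣q∣; ∣p∣≤n)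
open import Data.Vec using (_∷_; here; there; lookup)
open import Data.Vec.Properties using (lookup⇒[]=)
open import Data.Sum using (_⊎_; inj₁; inj₂; [_,_])
import Data.Sum as Sum
open import Data.Product using (∃; _×_; _,_; proj₁; proj₂; map₁; map₂)
open import Data.Empty using (⊥; ⊥-elim)
open import Relation.Nullary using (¬_; yes; no; Dec)
open import Relation.Nullary.Decidable using (_⊎-dec_; _×-dec_; ¬?)
open import Relation.Binary.PropositionalEquality using (_≡_; _≢_; refl; sym; trans; subst; ≢-sym)
open import Function using (_∘_; id)
open import Function.Bundles using (_⇔_; mk⇔)

module _ {n : ℕ} {p : Subset n} {v : Fin n} where

  v∈p∪⁅v⁆ : v ∈ p ∪ ⁅ v ⁆
  v∈p∪⁅v⁆ = q⊆p∪q p ⁅ v ⁆ (x∈⁅x⁆ v)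

  module _ {x : Fin n} where

    x∈p∪⁅v⁆⁻ : x ∈ p ∪ ⁅ v ⁆ → x ∈ p ⊎ x ≡ v
    x∈p∪⁅v⁆⁻ = Sum.map₂ (x∈⁅y⁆⇒x≡y v) ∘ x∈p∪q⁻ p ⁅ v ⁆

    x∈p⇒x∈p∪⁅v⁆ : x ∈ p → x ∈ p ∪ ⁅ v ⁆
    x∈p⇒x∈p∪⁅v⁆ = p⊆p∪q ⁅ v ⁆

    x∉p∪⁅v⁆ : x ∉ p → x ≢ v → x ∉ p ∪ ⁅ v ⁆
    x∉p∪⁅v⁆ x∉p x≢v = [ x∉p , x≢v ] ∘ x∈p∪⁅v⁆⁻

    x∉p∪⁅v⁆⁻ : x ∉ p ∪ ⁅ v ⁆ → x ∉ p × x ≢ v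
    x∉p∪⁅v⁆⁻ x∉ = x∉ ∘ x∈p⇒x∈p∪⁅v⁆ , λ { refl → x∉ v∈p∪⁅v⁆ }

x∈p─q⇒x∉q : ∀ {n} {x : Fin n} (p q : Subset n) → x ∈ p ─ q → x ∉ q
x∈p─q⇒x∉q (_ ∷ p) (outside ∷ q) here ()
x∈p─q⇒x∉q (_ ∷ p) (_ ∷ q) (there x∈) (there x∈q) = x∈p─q⇒x∉q p q x∈ x∈q

x∉p⇒lookup≡outside : ∀ {n} {x : Fin n} {p : Subset n} → x ∉ p → lookup p x ≡ outside
x∉p⇒lookup≡outside {x = x} {p} x∉p with lookup p x in eq
... | inside  = ⊥-elim (x∉p (lookup⇒[]= x p eq))
... | outside = refl

module _ {n : ℕ} (G : Graph n) where

  Adj-sym : ∀ {u v} → Adj G u v → Adj G v u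
  Adj-sym {u} {v} (u∈V , v∈V , e) = v∈V , u∈V , trans (E-sym G v u) e

  nonedge⇒¬Adj : ∀ {u v} → E G u v ≡ false → ¬ Adj G u v
  nonedge⇒¬Adj e≡false (_ , _ , e≡true) with trans (sym e≡true) e≡false
  ... | ()

  Attached : Subset n → Fin n → Set
  Attached C p = ∃ λ x → x ∉ C × Adj G p x

  attached? : ∀ C p → Dec (Attached C p)
  attached? C p = any? λ x →
    ¬? (x ∈? C) ×-dec (p ∈? V G) ×-dec (x ∈? V G) ×-dec (E G p x ≟ᵇ true)

  DominatesOutside : Subset n → Subset n → Set
  DominatesOutside C D = ∀ {x} → x ∈ V G → x ∉ C → ∃ λ u → u ∈ D × Adj G u x

  dominatesOutside-∪ : ∀ {C D w} → DominatesOutside C D → DominatesOutside C (D ∪ ⁅ w ⁆)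
  dominatesOutside-∪ dom x∈V x∉C with dom x∈V x∉C
  ... | u , u∈D , u~x = u , x∈p⇒x∈p∪⁅v⁆ u∈D , u~x

  module Deletion (C : Subset n) where

    ∈V-∖⁻ : ∀ {x} → x ∈ V (G ∖ C) → x ∈ V G × x ∉ C
    ∈V-∖⁻ x∈ = p─q⊆p (V G) C x∈ , x∈p─q⇒x∉q (V G) C x∈

    Adj-∖⁻ : ∀ {u v} → Adj (G ∖ C) u v → Adj G u v × u ∉ C
    Adj-∖⁻ {u} {v} (u∈ , v∈ , e) =
      (proj₁ (∈V-∖⁻ u∈) , proj₁ (∈V-∖⁻ v∈) , last-conjunct (not (lookup C u)) (not (lookup C v)) e)
      , proj₂ (∈V-∖⁻ u∈)
      where
      last-conjunct : ∀ x y {z} → x ∧ y ∧ z ≡ true → z ≡ true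
      last-conjunct true true e = e

    Adj-∖⁺ : ∀ {u v} → Adj G u v → u ∉ C → v ∉ C → Adj (G ∖ C) u v
    Adj-∖⁺ {u} {v} (u∈V , v∈V , e) u∉C v∉C =
      x∈p∧x∉q⇒x∈p─q u∈V u∉C , x∈p∧x∉q⇒x∈p─q v∈V v∉C , delE≡true
      where
      delE≡true : not (lookup C u) ∧ not (lookup C v) ∧ E G u v ≡ true
      delE≡true rewrite x∉p⇒lookup≡outside u∉C | x∉p⇒lookup≡outside v∉C = e

module _ {n : ℕ} (G : Graph n) where

  edge-nonseparable : ∀ {u v} → Adj G u v → Nonseparable G (⁅ u ⁆ ∪ ⁅ v ⁆)
  edge-nonseparable {u} {v} u~v = ⊆V , (u , u∈) , connected , noCutVertex
    where
    U : Subset n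
    U = ⁅ u ⁆ ∪ ⁅ v ⁆

    u∈ : u ∈ U
    u∈ = x∈p⇒x∈p∪⁅v⁆ (x∈⁅x⁆ u)

    endpoint : ∀ {x} → x ∈ U → x ≡ u ⊎ x ≡ v
    endpoint = Sum.map₁ (x∈⁅y⁆⇒x≡y u) ∘ x∈p∪⁅v⁆⁻

    ⊆V : U ⊆ V G
    ⊆V x∈ with endpoint x∈
    ... | inj₁ refl = proj₁ u~v
    ... | inj₂ refl = proj₁ (proj₂ u~v)

    connected : ConnectedIn G U
    connected x y x∈ y∈ with endpoint x∈ | endpoint y∈
    ... | inj₁ refl | inj₁ refl = stay x∈ (⊆V x∈)
    ... | inj₁ refl | inj₂ refl = step x∈ u~v (stay y∈ (⊆V y∈))
    ... | inj₂ refl | inj₁ refl = step x∈ (Adj-sym G u~v) (stay y∈ (⊆V y∈))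
    ... | inj₂ refl | inj₂ refl = stay x∈ (⊆V x∈)

    -- Removing either endpoint leaves at most one vertex.
    noCutVertex : ∀ z → z ∈ U → ConnectedIn G (U ─ ⁅ z ⁆)
    noCutVertex z z∈ x y x∈ y∈ with endpoint z∈
      | endpoint (p─q⊆p U ⁅ z ⁆ x∈) | x∈p─q⇒x∉q U ⁅ z ⁆ x∈
      | endpoint (p─q⊆p U ⁅ z ⁆ y∈) | x∈p─q⇒x∉q U ⁅ z ⁆ y∈
    ... | _ | inj₁ refl | _ | inj₁ refl | _ = stay x∈ (⊆V (p─q⊆p U ⁅ z ⁆ x∈))
    ... | _ | inj₂ refl | _ | inj₂ refl | _ = stay x∈ (⊆V (p─q⊆p U ⁅ z ⁆ x∈))
    ... | inj₁ refl | inj₁ refl | x∉ | _ | _ = ⊥-elim (x∉ (x∈⁅x⁆ z))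
    ... | inj₂ refl | inj₂ refl | x∉ | _ | _ = ⊥-elim (x∉ (x∈⁅x⁆ z))
    ... | inj₁ refl | _ | _ | inj₁ refl | y∉ = ⊥-elim (y∉ (x∈⁅x⁆ z))
    ... | inj₂ refl | _ | _ | inj₂ refl | y∉ = ⊥-elim (y∉ (x∈⁅x⁆ z))

  -- k is fuel: every proper superset of U is larger, so U grows at most n ∸ ∣ U ∣ times.
  ¬¬block⊇ : ∀ k {U} → n ≤ ∣ U ∣ + k → Nonseparable G U → ¬ ¬ (∃ λ B → U ⊆ B × IsBlock G B)
  ¬¬block⊇ k {U} bound ns noBlock = noBlock (U , id , ns , maximal)
    where
    maximal : ∀ B → U ⊆ B → Nonseparable G B → B ⊆ U
    maximal B U⊆B nsB {x} x∈B with x ∈? U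
    ... | yes x∈U = x∈U
    ... | no x∉U = ⊥-elim (grow k bound)
      where
      U⊂B : U ⊂ B
      U⊂B = U⊆B , x , x∈B , x∉U

      grow : ∀ k → n ≤ ∣ U ∣ + k → ⊥
      grow zero bound′ =
        <⇒≱ (p⊂q⇒∣p∣<∣q∣ U⊂B) (≤-trans (∣p∣≤n B) (subst (n ≤_) (+-identityʳ ∣ U ∣) bound′))
      grow (suc k′) bound′ =
        ¬¬block⊇ k′ (≤-trans bound′ (subst (_≤ ∣ B ∣ + k′) (sym (+-suc ∣ U ∣ k′))
                                      (+-monoˡ-≤ k′ (p⊂q⇒∣p∣<∣q∣ U⊂B))))
                 nsB (λ { (B′ , B⊆B′ , block) → noBlock (B′ , B⊆B′ ∘ U⊆B , block) })

  ¬¬edge⊆block : ∀ {u v} → Adj G u v → ¬ ¬ (∃ λ B → ⁅ u ⁆ ∪ ⁅ v ⁆ ⊆ B × IsBlock G B)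
  ¬¬edge⊆block u~v = ¬¬block⊇ n (m≤n+m n _) (edge-nonseparable u~v)

  -- An edge leaving C lies in a block other than C, which meets C in its inner endpoint.
  endBlock-attachment-unique : ∀ {C p q} → IsEndBlock G C → p ∈ C → q ∈ C →
                               Attached G C p → Attached G C q → p ≡ q
  endBlock-attachment-unique {C} {p} {q} (_ , endBlock) p∈C q∈C (x , x∉C , p~x) (y , y∉C , q~y)
    with p ≟ q
  ... | yes p≡q = p≡q
  ... | no p≢q =
    ⊥-elim (¬¬edge⊆block p~x λ { (B₁ , px⊆B₁ , block₁) →
            ¬¬edge⊆block q~y λ { (B₂ , qy⊆B₂ , block₂) →
              p≢q (endBlock B₁ B₂ p q block₁ block₂
                     (λ { refl → x∉C (px⊆B₁ v∈p∪⁅v⁆) }) (λ { refl → y∉C (qy⊆B₂ v∈p∪⁅v⁆) })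
                     p∈C (px⊆B₁ (x∈p⇒x∈p∪⁅v⁆ (x∈⁅x⁆ p))) q∈C (qy⊆B₂ (x∈p⇒x∈p∪⁅v⁆ (x∈⁅x⁆ q)))) } })

module _ {n : ℕ} where

  record Square (G : Graph n) (C : Subset n) (a b c d : Fin n) : Set where
    field
      a≢b : a ≢ b
      a≢c : a ≢ c
      a≢d : a ≢ d
      b≢c : b ≢ c
      b≢d : b ≢ d
      c≢d : c ≢ d
      cover : ∀ x → x ∈ C → x ≡ a ⊎ x ≡ b ⊎ x ≡ c ⊎ x ≡ d
      a∈C : a ∈ C
      b∈C : b ∈ C
      c∈C : c ∈ C
      d∈C : d ∈ C
      a~b : Adj G a b
      b~c : Adj G b c
      c~d : Adj G c d
      d~a : Adj G d a
      ac∉E : E G a c ≡ false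
      bd∉E : E G b d ≡ false

  InducesC4⇒Square : ∀ {G C} → InducesC4 G C → ∃ λ a → ∃ λ b → ∃ λ c → ∃ λ d → Square G C a b c d
  InducesC4⇒Square (a , b , c , d , a≢b , a≢c , a≢d , b≢c , b≢d , c≢d , cover ,
                    a∈C , b∈C , c∈C , d∈C , a~b , b~c , c~d , d~a , ac∉E , bd∉E) =
    a , b , c , d , record
      { a≢b = a≢b ; a≢c = a≢c ; a≢d = a≢d ; b≢c = b≢c ; b≢d = b≢d ; c≢d = c≢d ; cover = cover
      ; a∈C = a∈C ; b∈C = b∈C ; c∈C = c∈C ; d∈C = d∈C
      ; a~b = a~b ; b~c = b~c ; c~d = c~d ; d~a = d~a ; ac∉E = ac∉E ; bd∉E = bd∉E }

  rotate : ∀ {G C a b c d} → Square G C a b c d → Square G C b c d a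
  rotate {G} {C} {a} {b} {c} {d} sq = record
    { a≢b = b≢c ; a≢c = b≢d ; a≢d = ≢-sym a≢b ; b≢c = c≢d ; b≢d = ≢-sym a≢c ; c≢d = ≢-sym a≢d
    ; cover = cover′
    ; a∈C = b∈C ; b∈C = c∈C ; c∈C = d∈C ; d∈C = a∈C
    ; a~b = b~c ; b~c = c~d ; c~d = d~a ; d~a = a~b
    ; ac∉E = bd∉E ; bd∉E = trans (E-sym G c a) ac∉E }
    where
    open Square sq
    cover′ : ∀ x → x ∈ C → x ≡ b ⊎ x ≡ c ⊎ x ≡ d ⊎ x ≡ a
    cover′ x x∈C with cover x x∈C
    ... | inj₁ x≡a = inj₂ (inj₂ (inj₂ x≡a))
    ... | inj₂ x≡b⊎c⊎d = Sum.map₂ (Sum.map₂ inj₁) x≡b⊎c⊎d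

  RootedSquare : Graph n → Subset n → Set
  RootedSquare G C = ∃ λ a → ∃ λ b → ∃ λ c → ∃ λ d →
    Square G C a b c d × (∀ {q} → q ∈ C → Attached G C q → q ≡ a)

  endBlock-rootedAt : ∀ {G C p q r s} → IsEndBlock G C → Square G C p q r s → Attached G C p →
                      RootedSquare G C
  endBlock-rootedAt {G} {p = p} {q} {r} {s} eb sq p* =
    p , q , r , s , sq , λ x∈C x* → endBlock-attachment-unique G eb x∈C (Square.a∈C sq) x* p*

  endBlock-rootedSquare : ∀ {G C a b c d} → IsEndBlock G C → Square G C a b c d → RootedSquare G C
  endBlock-rootedSquare {G} {C} {a} {b} {c} {d} eb sq
    with attached? G C b | attached? G C c | attached? G C d
  ... | yes b* | _ | _ = endBlock-rootedAt eb (rotate sq) b*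
  ... | no _ | yes c* | _ = endBlock-rootedAt eb (rotate (rotate sq)) c*
  ... | no _ | no _ | yes d* = endBlock-rootedAt eb (rotate (rotate (rotate sq))) d*
  ... | no ¬b* | no ¬c* | no ¬d* = a , b , c , d , sq , onlyA
    where
    open Square sq
    onlyA : ∀ {q} → q ∈ C → Attached G C q → q ≡ a
    onlyA {q} q∈C q* with cover q q∈C
    ... | inj₁ q≡a = q≡a
    ... | inj₂ (inj₁ refl) = ⊥-elim (¬b* q*)
    ... | inj₂ (inj₂ (inj₁ refl)) = ⊥-elim (¬c* q*)
    ... | inj₂ (inj₂ (inj₂ refl)) = ⊥-elim (¬d* q*)

module _ {n : ℕ} (G : Graph n) where

  free? : ∀ D S → Dec (∃ (Free G D S))
  free? D S = any? λ v → (v ∈? V G) ×-dec ¬? (v ∈? D) ×-dec ¬? (v ∈? S)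

  ¬IsTD-∅ : ∀ {x} → x ∈ V G → ¬ IsTD G ∅
  ¬IsTD-∅ x∈V td = ∉⊥ (proj₁ (proj₂ (td _ x∈V)))

  Isolated : Fin n → Subset n → Subset n → Set
  Isolated x D S = ∀ {u} → Adj G u x → u ∈ S × u ∉ D

  mutual
    ¬DomWinsS-isolated : ∀ {x D S} → x ∈ V G → Isolated x D S → ¬ DomWinsS G D S
    ¬DomWinsS-isolated x∈V iso (wonS td) with td _ x∈V
    ... | u , u∈D , u~x = proj₂ (iso u~x) u∈D
    ¬DomWinsS-isolated x∈V iso (sMoves (v , v-free) f) =
      ¬DomWinsD-isolated x∈V (map₁ x∈p⇒x∈p∪⁅v⁆ ∘ iso) (f v v-free)

    ¬DomWinsD-isolated : ∀ {x D S} → x ∈ V G → Isolated x D S → ¬ DomWinsD G D S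
    ¬DomWinsD-isolated x∈V iso (wonD td) with td _ x∈V
    ... | u , u∈D , u~x = proj₂ (iso u~x) u∈D
    ¬DomWinsD-isolated {x} {D} {S} x∈V iso (dMoves w (_ , _ , w∉S) k) =
      ¬DomWinsS-isolated x∈V iso′ k
      where
      iso′ : Isolated x (D ∪ ⁅ w ⁆) S
      iso′ u~x with iso u~x
      ... | u∈S , u∉D = u∈S , x∉p∪⁅v⁆ u∉D λ { refl → w∉S u∈S }

module Restriction {n : ℕ} (G : Graph n) (C : Subset n) where

  open Deletion G C

  AgreeOutside : Subset n → Subset n → Set
  AgreeOutside X Y = ∀ {x} → x ∉ C → (x ∈ X → x ∈ Y) × (x ∈ Y → x ∈ X)

  Mirrors : Subset n → Subset n → Subset n → Subset n → Set
  Mirrors D S D′ S′ = AgreeOutside D D′ × AgreeOutside S S′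

  agree-refl : ∀ {X} → AgreeOutside X X
  agree-refl _ = id , id

  agree-∪ : ∀ {X Y v} → AgreeOutside X Y → AgreeOutside (X ∪ ⁅ v ⁆) (Y ∪ ⁅ v ⁆)
  agree-∪ {X} {Y} {v} agree {x} x∉C = extend (proj₁ (agree x∉C)) , extend (proj₂ (agree x∉C))
    where
    extend : ∀ {P Q} → (x ∈ P → x ∈ Q) → x ∈ P ∪ ⁅ v ⁆ → x ∈ Q ∪ ⁅ v ⁆
    extend P⇒Q x∈ with x∈p∪⁅v⁆⁻ x∈
    ... | inj₁ x∈P = x∈p⇒x∈p∪⁅v⁆ (P⇒Q x∈P)
    ... | inj₂ refl = v∈p∪⁅v⁆

  agree-∪ᶜ : ∀ {X Y v} → v ∈ C → AgreeOutside X Y → AgreeOutside (X ∪ ⁅ v ⁆) Y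
  agree-∪ᶜ {X} {Y} {v} v∈C agree {x} x∉C = restrict , x∈p⇒x∈p∪⁅v⁆ ∘ proj₂ (agree x∉C)
    where
    restrict : x ∈ X ∪ ⁅ v ⁆ → x ∈ Y
    restrict x∈ with x∈p∪⁅v⁆⁻ x∈
    ... | inj₁ x∈X = proj₁ (agree x∉C) x∈X
    ... | inj₂ refl = ⊥-elim (x∉C v∈C)

  mirrors-∪ᶜ : ∀ {D S D′ S′ w v} → w ∈ C → v ∈ C →
               Mirrors D S D′ S′ → Mirrors (D ∪ ⁅ w ⁆) (S ∪ ⁅ v ⁆) D′ S′
  mirrors-∪ᶜ w∈C v∈C (agreeD , agreeS) = agree-∪ᶜ w∈C agreeD , agree-∪ᶜ v∈C agreeS

  free-∖⁻ : ∀ {D S D′ S′ v} → Free (G ∖ C) D′ S′ v → Mirrors D S D′ S′ → Free G D S v × v ∉ C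
  free-∖⁻ (v∈ , v∉D′ , v∉S′) (agreeD , agreeS) with ∈V-∖⁻ v∈
  ... | v∈V , v∉C = (v∈V , v∉D′ ∘ proj₁ (agreeD v∉C) , v∉S′ ∘ proj₁ (agreeS v∉C)) , v∉C

  free-∖⁺ : ∀ {D S D′ S′ v} → Free G D S v → v ∉ C → Mirrors D S D′ S′ → Free (G ∖ C) D′ S′ v
  free-∖⁺ (v∈V , v∉D , v∉S) v∉C (agreeD , agreeS) =
    x∈p∧x∉q⇒x∈p─q v∈V v∉C , v∉D ∘ proj₂ (agreeD v∉C) , v∉S ∘ proj₂ (agreeS v∉C)

  IsTD-∖⇒dominatesOutside : ∀ {D D′} → IsTD (G ∖ C) D′ → AgreeOutside D D′ → DominatesOutside G C D
  IsTD-∖⇒dominatesOutside td agree x∈V x∉C with td _ (x∈p∧x∉q⇒x∈p─q x∈V x∉C)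
  ... | u , u∈D′ , u~x with Adj-∖⁻ u~x
  ... | u~ᴳx , u∉C = u , proj₂ (agree u∉C) u∈D′ , u~ᴳx

  IsTD⇒IsTD-∖ : ∀ {D D′} → IsTD G D → (∀ {u} → u ∈ D → u ∈ C → ¬ Attached G C u) →
                AgreeOutside D D′ → IsTD (G ∖ C) D′
  IsTD⇒IsTD-∖ td unattached agree x x∈ with ∈V-∖⁻ x∈
  ... | x∈V , x∉C with td x x∈V
  ... | u , u∈D , u~x with u ∈? C
  ... | yes u∈C = ⊥-elim (unattached u∈D u∈C (x , x∉C , u~x))
  ... | no u∉C = u , proj₁ (agree u∉C) u∈D , Adj-∖⁺ u~x u∉C x∉C

module _ {n : ℕ} where

  OneOf : Fin n → Fin n → Fin n → Set
  OneOf v p q = v ≡ p ⊎ v ≡ q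

  Fresh : Subset n → Subset n → Fin n → Fin n → Set
  Fresh D S p q = p ∉ D × p ∉ S × q ∉ D × q ∉ S

  Split : Subset n → Subset n → Fin n → Fin n → Set
  Split D S p q = (p ∈ D × q ∈ S) ⊎ (q ∈ D × p ∈ S)

  Secured : Subset n → Fin n → Fin n → Set
  Secured D p q = p ∈ D ⊎ q ∈ D

  module _ {D S : Subset n} {p q v : Fin n} where

    Fresh-∪S : ¬ OneOf v p q → Fresh D S p q → Fresh D (S ∪ ⁅ v ⁆) p q
    Fresh-∪S v∉ (p∉D , p∉S , q∉D , q∉S) =
      p∉D , x∉p∪⁅v⁆ p∉S (v∉ ∘ inj₁ ∘ sym) , q∉D , x∉p∪⁅v⁆ q∉S (v∉ ∘ inj₂ ∘ sym)

    Fresh-∪D : ¬ OneOf v p q → Fresh D S p q → Fresh (D ∪ ⁅ v ⁆) S p q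
    Fresh-∪D v∉ (p∉D , p∉S , q∉D , q∉S) =
      x∉p∪⁅v⁆ p∉D (v∉ ∘ inj₁ ∘ sym) , p∉S , x∉p∪⁅v⁆ q∉D (v∉ ∘ inj₂ ∘ sym) , q∉S

    Split-∪S : Split D S p q → Split D (S ∪ ⁅ v ⁆) p q
    Split-∪S = Sum.map (map₂ x∈p⇒x∈p∪⁅v⁆) (map₂ x∈p⇒x∈p∪⁅v⁆)

    Split-∪D : Split D S p q → Split (D ∪ ⁅ v ⁆) S p q
    Split-∪D = Sum.map (map₁ x∈p⇒x∈p∪⁅v⁆) (map₁ x∈p⇒x∈p∪⁅v⁆)

    Split⇒¬Free : ∀ G → Split D S p q → OneOf v p q → ¬ Free G D S v
    Split⇒¬Free _ (inj₁ (p∈D , _)) (inj₁ refl) (_ , v∉D , _) = v∉D p∈D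
    Split⇒¬Free _ (inj₁ (_ , q∈S)) (inj₂ refl) (_ , _ , v∉S) = v∉S q∈S
    Split⇒¬Free _ (inj₂ (_ , p∈S)) (inj₁ refl) (_ , _ , v∉S) = v∉S p∈S
    Split⇒¬Free _ (inj₂ (q∈D , _)) (inj₂ refl) (_ , v∉D , _) = v∉D q∈D

  Secured-∪D : ∀ {D p q v} → Secured D p q → Secured (D ∪ ⁅ v ⁆) p q
  Secured-∪D = Sum.map x∈p⇒x∈p∪⁅v⁆ x∈p⇒x∈p∪⁅v⁆

  Secured⇒dominates : ∀ G {D p q x} → Secured D p q → (∀ {u} → OneOf u p q → Adj G u x) →
                      ∃ λ u → u ∈ D × Adj G u x
  Secured⇒dominates _ (inj₁ p∈D) adj = _ , p∈D , adj (inj₁ refl)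
  Secured⇒dominates _ (inj₂ q∈D) adj = _ , q∈D , adj (inj₂ refl)

  Split⇒Secured : ∀ {D S p q} → Split D S p q → Secured D p q
  Split⇒Secured = Sum.map proj₁ proj₁

  record Pair (G : Graph n) (p q : Fin n) : Set where
    field
      p≢q : p ≢ q
      p∈V : p ∈ V G
      q∈V : q ∈ V G

  module _ {G : Graph n} {p q : Fin n} (pair : Pair G p q) where

    open Pair pair

    Fresh⇒Free : ∀ {D S} → Fresh D S p q → Free G D S p
    Fresh⇒Free (p∉D , p∉S , _) = p∈V , p∉D , p∉S

    answer : ∀ {D S v} → Fresh D S p q → OneOf v p q →
             ∃ λ w → Free G D (S ∪ ⁅ v ⁆) w × OneOf w p q × Split (D ∪ ⁅ w ⁆) (S ∪ ⁅ v ⁆) p q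
    answer (_ , _ , q∉D , q∉S) (inj₁ refl) =
      q , (q∈V , q∉D , x∉p∪⁅v⁆ q∉S (≢-sym p≢q)) , inj₂ refl , inj₂ (v∈p∪⁅v⁆ , v∈p∪⁅v⁆)
    answer (p∉D , p∉S , _) (inj₂ refl) =
      p , (p∈V , p∉D , x∉p∪⁅v⁆ p∉S p≢q) , inj₁ refl , inj₁ (v∈p∪⁅v⁆ , v∈p∪⁅v⁆)

    counter : ∀ {D S w} → Fresh D S p q → OneOf w p q →
              ∃ λ v → Free G (D ∪ ⁅ w ⁆) S v × OneOf v p q × Split (D ∪ ⁅ w ⁆) (S ∪ ⁅ v ⁆) p q
    counter (_ , _ , q∉D , q∉S) (inj₁ refl) =
      q , (q∈V , x∉p∪⁅v⁆ q∉D (≢-sym p≢q) , q∉S) , inj₂ refl , inj₁ (v∈p∪⁅v⁆ , v∈p∪⁅v⁆)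
    counter (p∉D , p∉S , _) (inj₂ refl) =
      p , (p∈V , x∉p∪⁅v⁆ p∉D p≢q , p∉S) , inj₁ refl , inj₂ (v∈p∪⁅v⁆ , v∈p∪⁅v⁆)

    secure : ∀ {D S} → Fresh D S p q → ∀ v →
             ∃ λ w → Free G D (S ∪ ⁅ v ⁆) w × OneOf w p q × Secured (D ∪ ⁅ w ⁆) p q
    secure fresh v with (v ≟ p) ⊎-dec (v ≟ q)
    ... | yes v∈ with answer fresh v∈
    ...   | w , w-free , w∈ , split = w , w-free , w∈ , Split⇒Secured split
    secure (p∉D , p∉S , _) v | no v∉ =
      p , (p∈V , p∉D , x∉p∪⁅v⁆ p∉S (v∉ ∘ inj₁ ∘ sym)) , inj₁ refl , inj₁ v∈p∪⁅v⁆

module _ {n : ℕ} where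

  record PairedBy (G : Graph n) (C : Subset n) (p₁ q₁ p₂ q₂ : Fin n) : Set where
    field
      pair₁ : Pair G p₁ q₁
      pair₂ : Pair G p₂ q₂
      apart : ∀ {v} → OneOf v p₁ q₁ → ¬ OneOf v p₂ q₂
      cover : ∀ {v} → v ∈ C → OneOf v p₁ q₁ ⊎ OneOf v p₂ q₂
      inside₁ : ∀ {v} → OneOf v p₁ q₁ → v ∈ C
      inside₂ : ∀ {v} → OneOf v p₂ q₂ → v ∈ C
      secured⇒IsTD : ∀ {D} → DominatesOutside G C D → Secured D p₁ q₁ → Secured D p₂ q₂ → IsTD G D

  swapPairs : ∀ {G C p₁ q₁ p₂ q₂} → PairedBy G C p₁ q₁ p₂ q₂ → PairedBy G C p₂ q₂ p₁ q₁
  swapPairs pb = record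
    { pair₁ = pair₂ ; pair₂ = pair₁
    ; apart = λ v∈₂ v∈₁ → apart v∈₁ v∈₂
    ; cover = Sum.swap ∘ cover
    ; inside₁ = inside₂ ; inside₂ = inside₁
    ; secured⇒IsTD = λ dom secured₂ secured₁ → secured⇒IsTD dom secured₁ secured₂ }
    where open PairedBy pb

  diagonals : ∀ {G C a b c d} → Square G C a b c d → PairedBy G C a c b d
  diagonals {G} {C} {a} {b} {c} {d} sq = record
    { pair₁ = record { p≢q = a≢c ; p∈V = proj₁ a~b ; q∈V = proj₁ c~d }
    ; pair₂ = record { p≢q = b≢d ; p∈V = proj₁ b~c ; q∈V = proj₁ d~a }
    ; apart = disjoint
    ; cover = cover′
    ; inside₁ = [ (λ { refl → a∈C }) , (λ { refl → c∈C }) ]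
    ; inside₂ = [ (λ { refl → b∈C }) , (λ { refl → d∈C }) ]
    ; secured⇒IsTD = dominating }
    where
    open Square sq

    disjoint : ∀ {v} → OneOf v a c → ¬ OneOf v b d
    disjoint (inj₁ refl) = [ a≢b , a≢d ]
    disjoint (inj₂ refl) = [ ≢-sym b≢c , c≢d ]

    cover′ : ∀ {v} → v ∈ C → OneOf v a c ⊎ OneOf v b d
    cover′ v∈C with cover _ v∈C
    ... | inj₁ v≡a = inj₁ (inj₁ v≡a)
    ... | inj₂ (inj₁ v≡b) = inj₂ (inj₁ v≡b)
    ... | inj₂ (inj₂ (inj₁ v≡c)) = inj₁ (inj₂ v≡c)
    ... | inj₂ (inj₂ (inj₂ v≡d)) = inj₂ (inj₂ v≡d)

    ac~bd : ∀ {u x} → OneOf u a c → OneOf x b d → Adj G u x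
    ac~bd (inj₁ refl) (inj₁ refl) = a~b
    ac~bd (inj₁ refl) (inj₂ refl) = Adj-sym G d~a
    ac~bd (inj₂ refl) (inj₁ refl) = Adj-sym G b~c
    ac~bd (inj₂ refl) (inj₂ refl) = c~d

    dominating : ∀ {D} → DominatesOutside G C D → Secured D a c → Secured D b d → IsTD G D
    dominating dom secured-ac secured-bd x x∈V with x ∈? C
    ... | no x∉C = dom x∈V x∉C
    ... | yes x∈C with cover′ x∈C
    ...   | inj₁ x∈ac = Secured⇒dominates G secured-bd λ u∈bd → Adj-sym G (ac~bd x∈ac u∈bd)
    ...   | inj₂ x∈bd = Secured⇒dominates G secured-ac λ u∈ac → ac~bd u∈ac x∈bd

-- Dominator follows a strategy on G ∖ C and answers every move of Staller in C
-- inside the same pair. The subscript counts the pairs still untouched; the levels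
-- replace an induction on the number of free vertices of C.
module Pairing {n : ℕ} {G : Graph n} {C : Subset n} {p₁ q₁ p₂ q₂ : Fin n}
               (pb : PairedBy G C p₁ q₁ p₂ q₂) where

  open PairedBy pb
  open Restriction G C

  outside₁ : ∀ {v} → v ∉ C → ¬ OneOf v p₁ q₁
  outside₁ v∉C = v∉C ∘ inside₁

  pairingS₁ : ∀ {D S} → DominatesOutside G C D → Fresh D S p₁ q₁ → Secured D p₂ q₂ → DomWinsS G D S
  pairingS₁ dom fresh₁ secured₂ = sMoves (p₁ , Fresh⇒Free pair₁ fresh₁) respond
    where
    respond : ∀ v → _ → DomWinsD G _ (_ ∪ ⁅ v ⁆)
    respond v _ with secure pair₁ fresh₁ v
    ... | w , w-free , _ , secured₁ =
      dMoves w w-free (wonS (secured⇒IsTD (dominatesOutside-∪ G dom) secured₁ (Secured-∪D secured₂)))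

  mutual
    combineS₀ : ∀ {D S D′ S′} → DomWinsS (G ∖ C) D′ S′ → Split D S p₁ q₁ → Split D S p₂ q₂ →
                Mirrors D S D′ S′ → DomWinsS G D S
    combineS₀ (wonS td) split₁ split₂ m =
      wonS (secured⇒IsTD (IsTD-∖⇒dominatesOutside td (proj₁ m)) (Split⇒Secured split₁) (Split⇒Secured split₂))
    combineS₀ {D} {S} (sMoves (v₀ , v₀-free) f) split₁ split₂ m =
      sMoves (v₀ , proj₁ (free-∖⁻ v₀-free m)) respond
      where
      respond : ∀ v → Free G D S v → DomWinsD G D (S ∪ ⁅ v ⁆)
      respond v v-free =
        combineD₀ (f v (free-∖⁺ v-free v∉C m)) (Split-∪S split₁) (Split-∪S split₂) (map₂ agree-∪ m)
        where
        v∉C : v ∉ C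
        v∉C v∈C = [ (λ v∈₁ → Split⇒¬Free G split₁ v∈₁ v-free) , (λ v∈₂ → Split⇒¬Free G split₂ v∈₂ v-free) ] (cover v∈C)

    combineD₀ : ∀ {D S D′ S′} → DomWinsD (G ∖ C) D′ S′ → Split D S p₁ q₁ → Split D S p₂ q₂ →
                Mirrors D S D′ S′ → DomWinsD G D S
    combineD₀ (wonD td) split₁ split₂ m =
      wonD (secured⇒IsTD (IsTD-∖⇒dominatesOutside td (proj₁ m)) (Split⇒Secured split₁) (Split⇒Secured split₂))
    combineD₀ (dMoves w w-free k) split₁ split₂ m =
      dMoves w (proj₁ (free-∖⁻ w-free m)) (combineS₀ k (Split-∪D split₁) (Split-∪D split₂) (map₁ agree-∪ m))

  mutual
    combineS₁ : ∀ {D S D′ S′} → DomWinsS (G ∖ C) D′ S′ → Fresh D S p₁ q₁ → Split D S p₂ q₂ →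
                Mirrors D S D′ S′ → DomWinsS G D S
    combineS₁ (wonS td) fresh₁ split₂ m =
      pairingS₁ (IsTD-∖⇒dominatesOutside td (proj₁ m)) fresh₁ (Split⇒Secured split₂)
    combineS₁ {D} {S} h@(sMoves (v₀ , v₀-free) f) fresh₁ split₂ m =
      sMoves (v₀ , proj₁ (free-∖⁻ v₀-free m)) respond
      where
      respond : ∀ v → Free G D S v → DomWinsD G D (S ∪ ⁅ v ⁆)
      respond v v-free with v ∈? C
      ... | no v∉C = combineD₁ (f v (free-∖⁺ v-free v∉C m))
                       (Fresh-∪S (outside₁ v∉C) fresh₁) (Split-∪S split₂) (map₂ agree-∪ m)
      ... | yes v∈C with cover v∈C
      ...   | inj₂ v∈₂ = ⊥-elim (Split⇒¬Free G split₂ v∈₂ v-free)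
      ...   | inj₁ v∈₁ with answer pair₁ fresh₁ v∈₁
      ...     | w , w-free , w∈₁ , split₁ =
        dMoves w w-free (combineS₀ h split₁ (Split-∪D (Split-∪S split₂)) (mirrors-∪ᶜ (inside₁ w∈₁) v∈C m))

    combineD₁ : ∀ {D S D′ S′} → DomWinsD (G ∖ C) D′ S′ → Fresh D S p₁ q₁ → Split D S p₂ q₂ →
                Mirrors D S D′ S′ → DomWinsD G D S
    combineD₁ (wonD td) fresh₁ split₂ m =
      dMoves p₁ (Fresh⇒Free pair₁ fresh₁)
        (wonS (secured⇒IsTD (dominatesOutside-∪ G (IsTD-∖⇒dominatesOutside td (proj₁ m)))
                            (inj₁ v∈p∪⁅v⁆) (Secured-∪D (Split⇒Secured split₂))))
    combineD₁ (dMoves w w-free k) fresh₁ split₂ m with free-∖⁻ w-free m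
    ... | w-freeᴳ , w∉C =
      dMoves w w-freeᴳ (combineS₁ k (Fresh-∪D (outside₁ w∉C) fresh₁) (Split-∪D split₂) (map₁ agree-∪ m))

module PairingBoth {n : ℕ} {G : Graph n} {C : Subset n} {p₁ q₁ p₂ q₂ : Fin n}
                   (pb : PairedBy G C p₁ q₁ p₂ q₂) where

  open PairedBy pb
  open Restriction G C
  open Pairing pb
  module Swapped = Pairing (swapPairs pb)

  pairingS₂ : ∀ {D S} → DominatesOutside G C D → Fresh D S p₁ q₁ → Fresh D S p₂ q₂ → DomWinsS G D S
  pairingS₂ dom fresh₁ fresh₂ = sMoves (p₁ , Fresh⇒Free pair₁ fresh₁) respond
    where
    respond : ∀ v → _ → DomWinsD G _ (_ ∪ ⁅ v ⁆)
    respond v _ with (v ≟ p₂) ⊎-dec (v ≟ q₂)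
    ... | yes v∈₂ with answer pair₂ fresh₂ v∈₂
    ...   | w , w-free , w∈₂ , split₂ =
      dMoves w w-free (pairingS₁ (dominatesOutside-∪ G dom)
        (Fresh-∪D (λ w∈₁ → apart w∈₁ w∈₂) (Fresh-∪S (λ v∈₁ → apart v∈₁ v∈₂) fresh₁)) (Split⇒Secured split₂))
    respond v _ | no v∉₂ with secure pair₁ fresh₁ v
    ...   | w , w-free , w∈₁ , secured₁ =
      dMoves w w-free (Swapped.pairingS₁ (dominatesOutside-∪ G dom)
        (Fresh-∪D (apart w∈₁) (Fresh-∪S v∉₂ fresh₂)) secured₁)

  mutual
    combineS₂ : ∀ {D S D′ S′} → DomWinsS (G ∖ C) D′ S′ → Fresh D S p₁ q₁ → Fresh D S p₂ q₂ →
                Mirrors D S D′ S′ → DomWinsS G D S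
    combineS₂ (wonS td) fresh₁ fresh₂ m = pairingS₂ (IsTD-∖⇒dominatesOutside td (proj₁ m)) fresh₁ fresh₂
    combineS₂ {D} {S} h@(sMoves (v₀ , v₀-free) f) fresh₁ fresh₂ m =
      sMoves (v₀ , proj₁ (free-∖⁻ v₀-free m)) respond
      where
      respond : ∀ v → Free G D S v → DomWinsD G D (S ∪ ⁅ v ⁆)
      respond v v-free with v ∈? C
      ... | no v∉C = combineD₂ (f v (free-∖⁺ v-free v∉C m))
                       (Fresh-∪S (outside₁ v∉C) fresh₁) (Fresh-∪S (Swapped.outside₁ v∉C) fresh₂) (map₂ agree-∪ m)
      ... | yes v∈C with cover v∈C
      ...   | inj₁ v∈₁ with answer pair₁ fresh₁ v∈₁
      ...     | w , w-free , w∈₁ , split₁ =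
        dMoves w w-free (Swapped.combineS₁ h (Fresh-∪D (apart w∈₁) (Fresh-∪S (apart v∈₁) fresh₂))
                                             split₁ (mirrors-∪ᶜ (inside₁ w∈₁) v∈C m))
      respond v v-free | yes v∈C | inj₂ v∈₂ with answer pair₂ fresh₂ v∈₂
      ...     | w , w-free , w∈₂ , split₂ =
        dMoves w w-free (combineS₁ h (Fresh-∪D (λ w∈₁ → apart w∈₁ w∈₂) (Fresh-∪S (λ v∈₁ → apart v∈₁ v∈₂) fresh₁))
                                     split₂ (mirrors-∪ᶜ (inside₂ w∈₂) v∈C m))

    combineD₂ : ∀ {D S D′ S′} → DomWinsD (G ∖ C) D′ S′ → Fresh D S p₁ q₁ → Fresh D S p₂ q₂ →
                Mirrors D S D′ S′ → DomWinsD G D S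
    combineD₂ (wonD td) fresh₁ fresh₂ m =
      dMoves p₁ (Fresh⇒Free pair₁ fresh₁)
        (Swapped.pairingS₁ (dominatesOutside-∪ G (IsTD-∖⇒dominatesOutside td (proj₁ m)))
                           (Fresh-∪D (apart (inj₁ refl)) fresh₂) (inj₁ v∈p∪⁅v⁆))
    combineD₂ (dMoves w w-free k) fresh₁ fresh₂ m with free-∖⁻ w-free m
    ... | w-freeᴳ , w∉C =
      dMoves w w-freeᴳ (combineS₂ k (Fresh-∪D (outside₁ w∉C) fresh₁) (Fresh-∪D (Swapped.outside₁ w∉C) fresh₂)
                                    (map₁ agree-∪ m))

  lift : DominatorWinsSGame (G ∖ C) → DominatorWinsSGame G
  lift h = combineS₂ h untouched untouched (agree-refl , agree-refl)
    where
    untouched : ∀ {p q} → Fresh ∅ ∅ p q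
    untouched = ∉⊥ , ∉⊥ , ∉⊥ , ∉⊥

module Forward {n : ℕ} {G : Graph n} {C : Subset n} {a b c d : Fin n}
               (sq : Square G C a b c d) (onlyA : ∀ {q} → q ∈ C → Attached G C q → q ≡ a) where

  open Square sq
  open Restriction G C

  a∈V : a ∈ V G
  a∈V = proj₁ a~b

  b∈V : b ∈ V G
  b∈V = proj₁ b~c

  c∈V : c ∈ V G
  c∈V = proj₁ c~d

  pair-bd : Pair G b d
  pair-bd = record { p≢q = b≢d ; p∈V = b∈V ; q∈V = proj₁ d~a }

  bd⊆C : ∀ {v} → OneOf v b d → v ∈ C
  bd⊆C = [ (λ { refl → b∈C }) , (λ { refl → d∈C }) ]

  bd-≢a : ∀ {v} → OneOf v b d → v ≢ a
  bd-≢a (inj₁ refl) = ≢-sym a≢b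
  bd-≢a (inj₂ refl) = ≢-sym a≢d

  neighbour-of-b : ∀ {u} → Adj G u b → OneOf u a c
  neighbour-of-b {u} u~b with u ∈? C
  ... | no u∉C = ⊥-elim (≢-sym a≢b (onlyA b∈C (u , u∉C , Adj-sym G u~b)))
  ... | yes u∈C with cover u u∈C
  ...   | inj₁ u≡a = inj₁ u≡a
  ...   | inj₂ (inj₁ refl) = ⊥-elim (nonedge⇒¬Adj G (E-irr G b) u~b)
  ...   | inj₂ (inj₂ (inj₁ u≡c)) = inj₂ u≡c
  ...   | inj₂ (inj₂ (inj₂ refl)) = ⊥-elim (nonedge⇒¬Adj G bd∉E (Adj-sym G u~b))

  IsTD-restricts : ∀ {D D′} → IsTD G D → a ∉ D → AgreeOutside D D′ → IsTD (G ∖ C) D′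
  IsTD-restricts {D} td a∉D = IsTD⇒IsTD-∖ td λ u∈D u∈C u* → a∉D (subst (_∈ D) (onlyA u∈C u*) u∈D)

  record AfterOpening (D S D′ S′ : Subset n) : Set where
    field
      a∈S : a ∈ S
      a∉D : a ∉ D
      c∈D : c ∈ D
      bd : Fresh D S b d ⊎ Split D S b d
      mirrors : Mirrors D S D′ S′

  open AfterOpening

  opening : AfterOpening (∅ ∪ ⁅ c ⁆) (∅ ∪ ⁅ a ⁆) ∅ ∅
  opening = record
    { a∈S = v∈p∪⁅v⁆
    ; a∉D = x∉p∪⁅v⁆ ∉⊥ a≢c
    ; c∈D = v∈p∪⁅v⁆
    ; bd = inj₁ (x∉p∪⁅v⁆ ∉⊥ b≢c , x∉p∪⁅v⁆ ∉⊥ (≢-sym a≢b) , x∉p∪⁅v⁆ ∉⊥ (≢-sym c≢d) , x∉p∪⁅v⁆ ∉⊥ (≢-sym a≢d))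
    ; mirrors = agree-∪ᶜ c∈C agree-refl , agree-∪ᶜ a∈C agree-refl }

  module _ {D S D′ S′ : Subset n} (inv : AfterOpening D S D′ S′) where

    free∈C⇒bd : ∀ {v} → Free G D S v → v ∈ C → OneOf v b d
    free∈C⇒bd (_ , v∉D , v∉S) v∈C with cover _ v∈C
    ... | inj₁ refl = ⊥-elim (v∉S (a∈S inv))
    ... | inj₂ (inj₁ v≡b) = inj₁ v≡b
    ... | inj₂ (inj₂ (inj₁ refl)) = ⊥-elim (v∉D (c∈D inv))
    ... | inj₂ (inj₂ (inj₂ v≡d)) = inj₂ v≡d

    free∈bd⇒Fresh : ∀ {v} → OneOf v b d → Free G D S v → Fresh D S b d
    free∈bd⇒Fresh v∈ v-free = [ id , (λ split → ⊥-elim (Split⇒¬Free G split v∈ v-free)) ] (bd inv)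

    IsTD-restricts-at : IsTD G D → IsTD (G ∖ C) D′
    IsTD-restricts-at td = IsTD-restricts td (a∉D inv) (proj₁ (mirrors inv))

    AfterOpening-∪S : ∀ {v} → v ∉ C → AfterOpening D (S ∪ ⁅ v ⁆) D′ (S′ ∪ ⁅ v ⁆)
    AfterOpening-∪S v∉C = record
      { a∈S = x∈p⇒x∈p∪⁅v⁆ (a∈S inv) ; a∉D = a∉D inv ; c∈D = c∈D inv
      ; bd = Sum.map (Fresh-∪S (v∉C ∘ bd⊆C)) Split-∪S (bd inv)
      ; mirrors = map₂ agree-∪ (mirrors inv) }

    AfterOpening-∪D : ∀ {v} → v ∉ C → AfterOpening (D ∪ ⁅ v ⁆) S (D′ ∪ ⁅ v ⁆) S′
    AfterOpening-∪D v∉C = record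
      { a∈S = a∈S inv ; a∉D = x∉p∪⁅v⁆ (a∉D inv) (λ { refl → v∉C a∈C }) ; c∈D = x∈p⇒x∈p∪⁅v⁆ (c∈D inv)
      ; bd = Sum.map (Fresh-∪D (v∉C ∘ bd⊆C)) Split-∪D (bd inv)
      ; mirrors = map₁ agree-∪ (mirrors inv) }

    AfterOpening-split : ∀ {w v} → OneOf w b d → OneOf v b d → Split (D ∪ ⁅ w ⁆) (S ∪ ⁅ v ⁆) b d →
                         AfterOpening (D ∪ ⁅ w ⁆) (S ∪ ⁅ v ⁆) D′ S′
    AfterOpening-split w∈ v∈ split = record
      { a∈S = x∈p⇒x∈p∪⁅v⁆ (a∈S inv) ; a∉D = x∉p∪⁅v⁆ (a∉D inv) (≢-sym (bd-≢a w∈))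
      ; c∈D = x∈p⇒x∈p∪⁅v⁆ (c∈D inv) ; bd = inj₂ split
      ; mirrors = mirrors-∪ᶜ (bd⊆C w∈) (bd⊆C v∈) (mirrors inv) }

  -- When G ∖ C has no free vertex left, Staller takes b and Dominator's reply d
  -- leaves the board of G full as well.
  mutual
    exhaustedS : ∀ {D S D′ S′} → DomWinsS G D S → AfterOpening D S D′ S′ →
                 ¬ ∃ (Free (G ∖ C) D′ S′) → IsTD (G ∖ C) D′
    exhaustedS (wonS td) inv _ = IsTD-restricts-at inv td
    exhaustedS (sMoves (v , v-free) f) inv none with v ∈? C
    ... | no v∉C = ⊥-elim (none (v , free-∖⁺ v-free v∉C (mirrors inv)))
    ... | yes v∈C =
      exhaustedD (f b (Fresh⇒Free pair-bd (free∈bd⇒Fresh inv (free∈C⇒bd inv v-free v∈C) v-free))) inv none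

    exhaustedD : ∀ {D S D′ S′} → DomWinsD G D (S ∪ ⁅ b ⁆) → AfterOpening D S D′ S′ →
                 ¬ ∃ (Free (G ∖ C) D′ S′) → IsTD (G ∖ C) D′
    exhaustedD (wonD td) inv _ = IsTD-restricts-at inv td
    exhaustedD (dMoves w (w∈V , w∉D , w∉S∪b) k) inv none with x∉p∪⁅v⁆⁻ w∉S∪b | w ∈? C
    ... | w∉S , _ | no w∉C = ⊥-elim (none (w , free-∖⁺ (w∈V , w∉D , w∉S) w∉C (mirrors inv)))
    ... | w∉S , w≢b | yes w∈C with free∈C⇒bd inv (w∈V , w∉D , w∉S) w∈C
    ...   | inj₁ w≡b = ⊥-elim (w≢b w≡b)
    ...   | inj₂ refl =
      exhaustedS k (AfterOpening-split inv (inj₂ refl) (inj₁ refl) (inj₂ (v∈p∪⁅v⁆ , v∈p∪⁅v⁆))) none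

  mutual
    shadowS : ∀ {D S D′ S′} → DomWinsS G D S → AfterOpening D S D′ S′ → DomWinsS (G ∖ C) D′ S′
    shadowS (wonS td) inv = wonS (IsTD-restricts-at inv td)
    shadowS {D′ = D′} {S′} h@(sMoves _ f) inv with free? (G ∖ C) D′ S′
    ... | no none = wonS (exhaustedS h inv none)
    ... | yes first = sMoves first respond
      where
      respond : ∀ v → Free (G ∖ C) D′ S′ v → DomWinsD (G ∖ C) D′ (S′ ∪ ⁅ v ⁆)
      respond v v-free with free-∖⁻ v-free (mirrors inv)
      ... | v-freeᴳ , v∉C = shadowD (f v v-freeᴳ) (AfterOpening-∪S inv v∉C)

    shadowD : ∀ {D S D′ S′} → DomWinsD G D S → AfterOpening D S D′ S′ → DomWinsD (G ∖ C) D′ S′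
    shadowD (wonD td) inv = wonD (IsTD-restricts-at inv td)
    shadowD (dMoves w w-free k) inv with w ∈? C
    ... | no w∉C = dMoves w (free-∖⁺ w-free w∉C (mirrors inv)) (shadowS k (AfterOpening-∪D inv w∉C))
    ... | yes w∈C = stallerAnswers k w∈bd (free∈bd⇒Fresh inv w∈bd w-free) inv
      where
      w∈bd : OneOf w b d
      w∈bd = free∈C⇒bd inv w-free w∈C

    stallerAnswers : ∀ {D S D′ S′ w} → DomWinsS G (D ∪ ⁅ w ⁆) S → OneOf w b d → Fresh D S b d →
                     AfterOpening D S D′ S′ → DomWinsD (G ∖ C) D′ S′
    stallerAnswers (wonS td) w∈ _ inv =
      wonD (IsTD-restricts td (x∉p∪⁅v⁆ (a∉D inv) (≢-sym (bd-≢a w∈))) (agree-∪ᶜ (bd⊆C w∈) (proj₁ (mirrors inv))))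
    stallerAnswers (sMoves _ f) w∈ fresh inv with counter pair-bd fresh w∈
    ... | v , v-free , v∈ , split = shadowD (f v v-free) (AfterOpening-split inv w∈ v∈ split)

  ¬dominates-b : ∀ {w u} → w ≢ a → w ≢ c → Adj G u b → u ∉ ∅ ∪ ⁅ w ⁆
  ¬dominates-b w≢a w≢c u~b u∈ with x∈p∪⁅v⁆⁻ u∈ | neighbour-of-b u~b
  ... | inj₁ u∈∅ | _ = ∉⊥ u∈∅
  ... | inj₂ refl | inj₁ refl = w≢a refl
  ... | inj₂ refl | inj₂ refl = w≢c refl

  ¬DomWins-reply≢c : ∀ {w} → w ≢ a → w ≢ c → ¬ DomWinsS G (∅ ∪ ⁅ w ⁆) (∅ ∪ ⁅ a ⁆)
  ¬DomWins-reply≢c w≢a w≢c (wonS td) with td b b∈V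
  ... | u , u∈D , u~b = ¬dominates-b w≢a w≢c u~b u∈D
  ¬DomWins-reply≢c {w} w≢a w≢c (sMoves _ f) =
    ¬DomWinsD-isolated G b∈V isolated (f c (c∈V , x∉p∪⁅v⁆ ∉⊥ (≢-sym w≢c) , x∉p∪⁅v⁆ ∉⊥ (≢-sym a≢c)))
    where
    isolated : Isolated G b (∅ ∪ ⁅ w ⁆) ((∅ ∪ ⁅ a ⁆) ∪ ⁅ c ⁆)
    isolated u~b =
      [ (λ { refl → x∈p⇒x∈p∪⁅v⁆ v∈p∪⁅v⁆ }) , (λ { refl → v∈p∪⁅v⁆ }) ] (neighbour-of-b u~b) ,
      ¬dominates-b w≢a w≢c u~b

  restrict : DominatorWinsSGame G → DominatorWinsSGame (G ∖ C)
  restrict (wonS td) = ⊥-elim (¬IsTD-∅ G a∈V td)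
  restrict (sMoves _ f) with f a (a∈V , ∉⊥ , ∉⊥)
  ... | wonD td = ⊥-elim (¬IsTD-∅ G a∈V td)
  ... | dMoves w (_ , _ , w∉S) k with w ≟ c
  ...   | yes refl = shadowS k opening
  ...   | no w≢c = ⊥-elim (¬DomWins-reply≢c (proj₂ (x∉p∪⁅v⁆⁻ w∉S)) w≢c k)

lemma5p2 : ∀ {n : ℕ} (G : Graph n) (C : Subset n) →
    Connected G → IsEndBlock G C → InducesC4 G C →
    (DominatorWinsSGame G ⇔ DominatorWinsSGame (G ∖ C))
lemma5p2 G C _ endBlock c4 with InducesC4⇒Square c4
... | _ , _ , _ , _ , square with endBlock-rootedSquare endBlock square
...   | _ , _ , _ , _ , rooted , onlyA = mk⇔ (Forward.restrict rooted onlyA) (PairingBoth.lift (diagonals rooted))
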